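{- For $1\le m,n\le N$ with $m\ne n$: (i) $L_mK_n=K_nL_m$; (ii) $R_mK_n=K_nR_m$; (iii) $qL_mK_m=K_mL_m$; (iv) $R_mK_m=qK_mR_m$.
   Context: $q$ a prime power, $N\ge1$, $H$ an $N$-dimensional $\mathbb{F}_q$-space, $P$ its set of subspaces, fixed full flag $0=x_0\subsetneq\cdots\subsetneq x_N=H$ ($\dim x_i=i$). Location of $y\in P$: the $\mu=(\mu_1,\ldots,\mu_N)\in\{0,1\}^N$ with $\dim(y\cap x_m)=\mu_1+\cdots+\mu_m$ for all $m$; $\widehat m$ the $m$-th unit vector. $y$ $m$-covers $z$ if $z\subseteq y$, $\dim z=\dim y-1$ and location$(y)$=location$(z)+\widehat m$. $K_m\in\mathrm{Mat}_P(\mathbb{C})$ is diagonal with $(K_m)_{y,y}=q^{1/2-\mu_m}$ where $\mu$ is the location of $y$; $(L_m)_{y,z}=1$ if $z$ $m$-covers $y$ and $0$ otherwise; $R_m=L_m^T$. -}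

module Defs where

open import Level using (Level)
open import Data.Bool using (Bool; true; false; _∧_; _∨_; not; if_then_else_)
import Data.Bool as B
open import Data.Nat using (ℕ; zero; suc; _∸_; _^_; _≡ᵇ_)
open import Data.Fin using (Fin; inject₁; toℕ)
import Data.Fin as F
open import Data.Vec using (Vec; []; _∷_; lookup; zipWith; replicate)
import Data.Vec as V
open import Data.List using (List; []; _∷_; [_]; map; concatMap; foldr; allFin; filterᵇ; length; upTo)
open import Data.Product using (∃)
open import Relation.Nullary using (¬_)
open import Relation.Nullary.Decidable using (⌊_⌋)
open import Relation.Binary.PropositionalEquality using (_≡_)
open import Algebra.Structures using (IsCommutativeRing)
open import Algebra.Bundles using (CommutativeRing)

-- A finite field with q elements, carried by Fin q.
-- (Such a field exists iff q is a prime power; it is F_q up to iso.)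

record FiniteField (q : ℕ) : Set where
  field
    _+_ _*_ : Fin q → Fin q → Fin q
    -_      : Fin q → Fin q
    0# 1#   : Fin q
    isCommutativeRing : IsCommutativeRing _≡_ _+_ _*_ -_ 0# 1#
    0≢1     : ¬ (0# ≡ 1#)
    inverse : ∀ a → ¬ (a ≡ 0#) → ∃ λ b → a * b ≡ 1#

allVecsOver : {A : Set} → List A → (k : ℕ) → List (Vec A k)
allVecsOver xs zero    = [ [] ]
allVecsOver xs (suc k) = concatMap (λ a → map (a ∷_) (allVecsOver xs k)) xs

-- Subsets of Fin q ^ n, as finite decision trees (Sub q n is a finite,
-- enumerable type; a subset is determined by its membership function).

Sub : ℕ → ℕ → Set
Sub q zero    = Bool
Sub q (suc n) = Vec (Sub q n) q

mem : ∀ {q n} → Sub q n → Vec (Fin q) n → Bool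
mem {n = zero}  b []      = b
mem {n = suc n} S (a ∷ v) = mem (lookup S a) v

allSub : (q n : ℕ) → List (Sub q n)
allSub q zero    = true ∷ false ∷ []
allSub q (suc n) = allVecsOver (allSub q n) q

_∩_ : ∀ {q n} → Sub q n → Sub q n → Sub q n
_∩_ {n = zero}  a b = a ∧ b
_∩_ {n = suc n} S T = zipWith _∩_ S T

allVecs : (q n : ℕ) → List (Vec (Fin q) n)
allVecs q n = allVecsOver (allFin q) n

allᵇ : {A : Set} → (A → Bool) → List A → Bool
allᵇ p = foldr (λ a b → p a ∧ b) true

countᵇ : {A : Set} → (A → Bool) → List A → ℕ
countᵇ p xs = length (filterᵇ p xs)

card : ∀ {q n} → Sub q n → ℕ
card {q} {n} S = countᵇ (mem S) (allVecs q n)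

_⊆ᵇ_ : ∀ {q n} → Sub q n → Sub q n → Bool
_⊆ᵇ_ {q} {n} z y = allᵇ (λ v → not (mem z v) ∨ mem y v) (allVecs q n)

_≟ˢ_ : ∀ {q n} → Sub q n → Sub q n → Bool
_≟ˢ_ {q} {n} y z = allᵇ (λ v → ⌊ mem y v B.≟ mem z v ⌋) (allVecs q n)

-- log base q: least d ≤ c with q ^ d = c (0 if none)
firstSuch : (ℕ → Bool) → List ℕ → ℕ
firstSuch p []       = 0
firstSuch p (d ∷ ds) = if p d then d else firstSuch p ds

logq : ℕ → ℕ → ℕ
logq q c = firstSuch (λ d → (q ^ d) ≡ᵇ c) (upTo (suc c))

module Space {q : ℕ} (𝔽 : FiniteField q) (N : ℕ) where
  open FiniteField 𝔽

  zeroV : Vec (Fin q) N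
  zeroV = replicate N 0#

  _⊕_ : Vec (Fin q) N → Vec (Fin q) N → Vec (Fin q) N
  u ⊕ v = zipWith _+_ u v

  _·_ : Fin q → Vec (Fin q) N → Vec (Fin q) N
  c · v = V.map (c *_) v

  isSubspace : Sub q N → Bool
  isSubspace S =
    mem S zeroV
    ∧ allᵇ (λ u → allᵇ (λ v → not (mem S u ∧ mem S v) ∨ mem S (u ⊕ v)) (allVecs q N)) (allVecs q N)
    ∧ allᵇ (λ c → allᵇ (λ v → not (mem S v) ∨ mem S (c · v)) (allVecs q N)) (allFin q)

  P : List (Sub q N)
  P = filterᵇ isSubspace (allSub q N)

  dim : Sub q N → ℕ
  dim S = logq q (card S)

  record IsFullFlag (x : Fin (suc N) → Sub q N) : Set where
    field
      subspace : ∀ i → isSubspace (x i) ≡ true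
      dimension : ∀ i → dim (x i) ≡ toℕ i
      nested : ∀ (k : Fin N) → (x (inject₁ k) ⊆ᵇ x (F.suc k)) ≡ true

  module Flag (x : Fin (suc N) → Sub q N) where

    -- location μ of y: dim (y ∩ x_m) = μ_1 + ... + μ_m, i.e.
    -- μ_m = dim (y ∩ x_m) - dim (y ∩ x_{m-1})   (index k : Fin N is m = k+1)
    location : Sub q N → Fin N → ℕ
    location y k = dim (y ∩ x (F.suc k)) ∸ dim (y ∩ x (inject₁ k))

    unit : Fin N → Fin N → ℕ
    unit m k = if ⌊ k F.≟ m ⌋ then 1 else 0

    covers : Fin N → Sub q N → Sub q N → Bool
    covers m y z =
      (z ⊆ᵇ y)
      ∧ (dim y ≡ᵇ suc (dim z))
      ∧ allᵇ (λ k → location y k ≡ᵇ (location z k Data.Nat.+ unit m k)) (allFin N)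

    -- Matrices indexed by P with entries in a commutative ring R containing
    -- s = q^{1/2} and t = q^{-1/2} (i.e. s * t = 1, s * s = q).
    module Mat {c ℓ : Level} (R : CommutativeRing c ℓ) (s t : CommutativeRing.Carrier R) where
      open CommutativeRing R renaming (_+_ to _+ᴿ_; _*_ to _*ᴿ_; 0# to 0ᴿ; 1# to 1ᴿ)

      Matrix : Set c
      Matrix = Sub q N → Sub q N → Carrier

      _⊗_ : Matrix → Matrix → Matrix
      (A ⊗ B) y z = foldr (λ w acc → (A y w *ᴿ B w z) +ᴿ acc) 0ᴿ P

      -- (K_m)_{y,y} = q^{1/2 - μ_m}, off-diagonal entries 0
      K : Fin N → Matrix
      K m y z = if y ≟ˢ z then (if location y m ≡ᵇ 0 then s else t) else 0ᴿ

      L : Fin N → Matrix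
      L m y z = if covers m z y then 1ᴿ else 0ᴿ

      R′ : Fin N → Matrix
      R′ m y z = L m z y

      _≈ᴹ_ : Matrix → Matrix → Set ℓ
      A ≈ᴹ B = ∀ y z → isSubspace y ≡ true → isSubspace z ≡ true → A y z ≈ B y z

      fromℕ : ℕ → Carrier
      fromℕ zero    = 0ᴿ
      fromℕ (suc n) = 1ᴿ +ᴿ fromℕ n

      _•_ : Carrier → Matrix → Matrix
      (a • A) y z = a *ᴿ A y z

-- Right and left multiplication by the diagonal matrix K_n scale the (y, z) entry by
-- q^{1/2 - μ_n(z)} and q^{1/2 - μ_n(y)}, while L_m and R_m are supported on pairs in which
-- one subspace m-covers the other, so that their locations differ by the unit vector m̂.
-- For n ≠ m the two scalars agree; for n = m they are q^{-1/2} and q^{1/2}, provided every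
-- location is a 0/1-vector, i.e. dim (y ∩ x_{k+1}) ≤ dim (y ∩ x_k) + 1. That is the geometric
-- input: for v ∈ x_{k+1} ∖ x_k the q translates x_k + c v are disjoint and lie in x_{k+1},
-- which has q · |x_k| points, so x_{k+1} = x_k + F_q v; if moreover v ∈ y, then
-- y ∩ x_{k+1} = (y ∩ x_k) + F_q v has q · |y ∩ x_k| points.

module Submission where

open import Defs
open import Level using (Level; 0ℓ)
open import Data.Nat using (ℕ; suc)
open import Data.Fin using (Fin; inject₁)
import Data.Fin as F
open import Data.Fin.Properties using (toℕ-inject₁)
open import Data.Product using (_×_; _,_; ∃)
open import Relation.Nullary using (¬_)
open import Relation.Binary.PropositionalEquality using (_≡_)
open import Algebra.Bundles using (CommutativeRing)

open import Data.Bool using (Bool; true; false; _∧_; _∨_; not; if_then_else_)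
import Data.Bool as B
open import Data.Bool.ListAction using (any)
open import Data.Bool.Properties
  using (T-≡; ∧-conicalˡ; ∧-conicalʳ; ∧-zeroʳ; ⇔→≡; not-¬; not-involutive)
open import Data.Empty using (⊥; ⊥-elim)
open import Data.List using (List; []; _∷_; map; length; foldr; upTo; allFin)
open import Data.List.Membership.Propositional using (_∈_; find; lose)
open import Data.List.Membership.Propositional.Properties
  using (∈-map⁺; ∈-map⁻; ∈-concatMap⁺; ∈-allFin; ∈-upTo⁺; ∈-filter⁺)
open import Data.List.Membership.Propositional.Properties.WithK using (unique∧set⇒bag)
open import Data.List.Properties using (filter-some; length-tabulate)
open import Data.List.Relation.Binary.Disjoint.Propositional using (Disjoint)
open import Data.List.Relation.Binary.BagAndSetEquality using (∼bag⇒↭)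
open import Data.List.Relation.Binary.Permutation.Propositional using (_↭_)
open import Data.List.Relation.Binary.Permutation.Propositional.Properties using (↭-length; filter-↭)
open import Data.List.Relation.Unary.All as All using (All)
import Data.List.Relation.Unary.All.Properties as All
open import Data.List.Relation.Unary.Any using (here; there; any?)
open import Data.List.Relation.Unary.Any.Properties using (any⁺; any⁻)
import Data.List.Relation.Unary.AllPairs as AllPairs
import Data.List.Relation.Unary.AllPairs.Properties as AllPairs
open import Data.List.Relation.Unary.Unique.Propositional using (Unique)
import Data.List.Relation.Unary.Unique.Propositional.Properties as Unique
open import Data.Nat using (zero; _+_; _*_; _^_; _≤_; _<_; z≤n; s≤s; z<s; NonZero; >-nonZero; _≡ᵇ_)
open import Data.Nat.Properties
  using ( +-suc; +-comm; +-identityʳ; +-cancelʳ-≤; m≤m+n; m<m+n; m≤n+o⇒m∸n≤o; n≤0⇒n≡0; n<1+n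
        ; <⇒≢; <⇒≤; <-trans; ≤-<-trans; ≤-trans; ≤-reflexive; ≤-antisym; <-cmp
        ; ^-monoʳ-<; *-cancelˡ-≡; *-cancelˡ-≤; ≡ᵇ⇒≡; ≡⇒≡ᵇ)
open import Data.Vec using (Vec; []; _∷_; lookup; zipWith)
import Data.Vec as V
open import Data.Vec.Properties
  using (∷-injectiveˡ; ∷-injectiveʳ; tabulate∘lookup; tabulate-cong; lookup-zipWith)
open import Function using (id; _∘_; _⇔_; Equivalence; mk⇔)
open import Relation.Binary.PropositionalEquality
  using (_≢_; refl; sym; trans; cong; cong₂; subst; module ≡-Reasoning)
open import Relation.Binary.Definitions using (tri<; tri≈; tri>)
open import Relation.Nullary.Decidable using (T?; toWitness; ⌊_⌋; yes; no)

private
  variable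
    A C : Set

-- Counting with Boolean predicates

Implies : (p p′ : A → Bool) → Set
Implies p p′ = ∀ x → p x ≡ true → p′ x ≡ true

→ᵇ-elim : ∀ {a b} → not a ∨ b ≡ true → a ≡ true → b ≡ true
→ᵇ-elim {true} b≡true refl = b≡true

∧-intro : ∀ {a b} → a ≡ true → b ≡ true → a ∧ b ≡ true
∧-intro refl refl = refl

countᵇ-cong : {p p′ : A → Bool} → (∀ x → p x ≡ p′ x) → ∀ xs → countᵇ p xs ≡ countᵇ p′ xs
countᵇ-cong eq [] = refl
countᵇ-cong {p = p} {p′} eq (x ∷ xs) with p x | p′ x | eq x
... | true  | .true  | refl = cong suc (countᵇ-cong eq xs)
... | false | .false | refl = countᵇ-cong eq xs

countᵇ-map : (p : A → Bool) (f : A → A) → ∀ xs → countᵇ p (map f xs) ≡ countᵇ (p ∘ f) xs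
countᵇ-map p f [] = refl
countᵇ-map p f (x ∷ xs) with p (f x)
... | true  = cong suc (countᵇ-map p f xs)
... | false = countᵇ-map p f xs

countᵇ-↭ : (p : A → Bool) {xs ys : List A} → xs ↭ ys → countᵇ p xs ≡ countᵇ p ys
countᵇ-↭ p xs↭ys = ↭-length (filter-↭ (T? ∘ p) xs↭ys)

countᵇ-positive : (p : A → Bool) {x : A} {xs : List A} → x ∈ xs → p x ≡ true → 0 < countᵇ p xs
countᵇ-positive p x∈xs px = filter-some (T? ∘ p) (lose x∈xs (Equivalence.from T-≡ px))

countᵇ-∨ : (p p′ : A → Bool) → (∀ x → p x ≡ true → p′ x ≡ true → ⊥) →
           ∀ xs → countᵇ (λ x → p x ∨ p′ x) xs ≡ countᵇ p xs + countᵇ p′ xs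
countᵇ-∨ p p′ disjoint [] = refl
countᵇ-∨ p p′ disjoint (x ∷ xs) with p x in px | p′ x in p′x
... | true  | true  = ⊥-elim (disjoint x px p′x)
... | true  | false = cong suc (countᵇ-∨ p p′ disjoint xs)
... | false | true  = trans (cong suc (countᵇ-∨ p p′ disjoint xs)) (sym (+-suc _ _))
... | false | false = countᵇ-∨ p p′ disjoint xs

countᵇ-split : (p p′ : A → Bool) → Implies p p′ →
  ∀ xs → countᵇ p′ xs ≡ countᵇ p xs + countᵇ (λ x → p′ x ∧ not (p x)) xs
countᵇ-split p p′ p⇒p′ xs =
  trans (countᵇ-cong split xs) (countᵇ-∨ p (λ x → p′ x ∧ not (p x)) disjoint xs)
  where
  split : ∀ x → p′ x ≡ (p x ∨ (p′ x ∧ not (p x)))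
  split x with p x in px
  ... | true  = p⇒p′ x px
  ... | false with p′ x
  ...   | true  = refl
  ...   | false = refl
  disjoint : ∀ x → p x ≡ true → p′ x ∧ not (p x) ≡ true → ⊥
  disjoint x px rest = not-¬ (∧-conicalʳ (p′ x) _ rest) (cong not px)

countᵇ-mono : (p p′ : A → Bool) → Implies p p′ → ∀ xs → countᵇ p xs ≤ countᵇ p′ xs
countᵇ-mono p p′ p⇒p′ xs = subst (countᵇ p xs ≤_) (sym (countᵇ-split p p′ p⇒p′ xs)) (m≤m+n _ _)

countᵇ-≡⇒Implies : (p p′ : A → Bool) → Implies p p′ →
  {xs : List A} → countᵇ p xs ≡ countᵇ p′ xs → ∀ {x} → x ∈ xs → p′ x ≡ true → p x ≡ true
countᵇ-≡⇒Implies p p′ p⇒p′ {xs} eq {x} x∈xs p′x with p x in px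
... | true  = refl
... | false = ⊥-elim (<⇒≢ count< (trans eq (countᵇ-split p p′ p⇒p′ xs)))
  where
  rest : p′ x ∧ not (p x) ≡ true
  rest = ∧-intro p′x (cong not px)
  count< : countᵇ p xs < countᵇ p xs + countᵇ (λ x → p′ x ∧ not (p x)) xs
  count< = m<m+n _ (countᵇ-positive (λ x → p′ x ∧ not (p x)) x∈xs rest)

countᵇ-any : (f : C → A → Bool) {cs : List C} → Unique cs →
  (∀ {c c′} x → f c x ≡ true → f c′ x ≡ true → c ≡ c′) →
  ∀ {k} xs → (∀ c → countᵇ (f c) xs ≡ k) →
  countᵇ (λ x → any (λ c → f c x) cs) xs ≡ length cs * k
countᵇ-any f {[]} _ _ xs _ = countᵇ-false xs
  where
  countᵇ-false : ∀ xs → countᵇ (λ _ → false) xs ≡ 0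
  countᵇ-false []       = refl
  countᵇ-false (_ ∷ xs) = countᵇ-false xs
countᵇ-any f {c ∷ cs} (c∉cs AllPairs.∷ unique) overlap⇒≡ xs counts =
  trans (countᵇ-∨ (f c) (λ x → any (λ c → f c x) cs) disjoint xs)
        (cong₂ _+_ (counts c) (countᵇ-any f unique overlap⇒≡ xs counts))
  where
  disjoint : ∀ x → f c x ≡ true → any (λ c → f c x) cs ≡ true → ⊥
  disjoint x fcx anyx with find (any⁻ (λ c → f c x) cs (Equivalence.from T-≡ anyx))
  ... | c′ , c′∈cs , fc′x =
    All.lookup c∉cs c′∈cs (overlap⇒≡ x fcx (Equivalence.to T-≡ fc′x))

countᵇ-∘-bijection : (p : A → Bool) {xs : List A} → Unique xs → (∀ x → x ∈ xs) →
  (f g : A → A) → (∀ x → f (g x) ≡ x) → (∀ x → g (f x) ≡ x) →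
  countᵇ (p ∘ f) xs ≡ countᵇ p xs
countᵇ-∘-bijection p {xs} unique complete f g f∘g g∘f =
  trans (sym (countᵇ-map p f xs)) (countᵇ-↭ p (∼bag⇒↭ (unique∧set⇒bag unique-fxs unique sameElements)))
  where
  unique-fxs : Unique (map f xs)
  unique-fxs = Unique.map⁺ (λ {x} {y} fx≡fy → trans (sym (g∘f x)) (trans (cong g fx≡fy) (g∘f y))) unique
  sameElements : ∀ {x} → (x ∈ map f xs) ⇔ (x ∈ xs)
  sameElements {x} =
    mk⇔ (λ _ → complete x) (λ _ → subst (_∈ map f xs) (f∘g x) (∈-map⁺ f (complete (g x))))

-- Enumerating vectors and subsets

allᵇ-∈ : (p : A → Bool) {xs : List A} → allᵇ p xs ≡ true → ∀ {x} → x ∈ xs → p x ≡ true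
allᵇ-∈ p {y ∷ _} all-p (here refl)  = ∧-conicalˡ (p y) _ all-p
allᵇ-∈ p {y ∷ _} all-p (there x∈xs) = allᵇ-∈ p (∧-conicalʳ (p y) _ all-p) x∈xs

allᵇ-universal : (p : A → Bool) → (∀ x → p x ≡ true) → ∀ xs → allᵇ p xs ≡ true
allᵇ-universal p all-p []       = refl
allᵇ-universal p all-p (x ∷ xs) = ∧-intro (all-p x) (allᵇ-universal p all-p xs)

allVecsOver-complete : {xs : List A} → (∀ a → a ∈ xs) → ∀ k (v : Vec A k) → v ∈ allVecsOver xs k
allVecsOver-complete complete zero    []      = here refl
allVecsOver-complete complete (suc k) (a ∷ v) =
  ∈-concatMap⁺ _ (lose (complete a) (∈-map⁺ (a ∷_) (allVecsOver-complete complete k v)))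

allVecsOver-unique : {xs : List A} → Unique xs → ∀ k → Unique (allVecsOver xs k)
allVecsOver-unique unique zero    = All.[] AllPairs.∷ AllPairs.[]
allVecsOver-unique {xs = xs} unique (suc k) =
  Unique.concat⁺ (All.map⁺ (All.universal (λ _ → Unique.map⁺ ∷-injectiveʳ tails) xs))
                 (AllPairs.map⁺ (AllPairs.map disjointHeads unique))
  where
  tails = allVecsOver-unique unique k
  disjointHeads : ∀ {a b} → a ≢ b → Disjoint (map (a ∷_) (allVecsOver xs k)) (map (b ∷_) (allVecsOver xs k))
  disjointHeads a≢b (v∈a∷ , v∈b∷) with ∈-map⁻ _ v∈a∷ | ∈-map⁻ _ v∈b∷
  ... | _ , _ , v≡a∷u | _ , _ , v≡b∷w = a≢b (∷-injectiveˡ (trans (sym v≡a∷u) v≡b∷w))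

allVecs-complete : ∀ {q n} (v : Vec (Fin q) n) → v ∈ allVecs q n
allVecs-complete {n = n} = allVecsOver-complete ∈-allFin n

allVecs-unique : ∀ q n → Unique (allVecs q n)
allVecs-unique q = allVecsOver-unique (Unique.allFin⁺ q)

allSub-complete : ∀ q n (S : Sub q n) → S ∈ allSub q n
allSub-complete q zero    true  = here refl
allSub-complete q zero    false = there (here refl)
allSub-complete q (suc n) S     = allVecsOver-complete (allSub-complete q n) q S

allSub-unique : ∀ q n → Unique (allSub q n)
allSub-unique q zero    = ((λ ()) All.∷ All.[]) AllPairs.∷ (All.[] AllPairs.∷ AllPairs.[])
allSub-unique q (suc n) = allVecsOver-unique (allSub-unique q n) q

mem-injective : ∀ {q n} {S T : Sub q n} → (∀ v → mem S v ≡ mem T v) → S ≡ T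
mem-injective {n = zero}  same = same []
mem-injective {n = suc n} {S} {T} same =
  trans (sym (tabulate∘lookup S))
        (trans (tabulate-cong (λ a → mem-injective (λ v → same (a ∷ v)))) (tabulate∘lookup T))

≟ˢ-sound : ∀ {q n} {S T : Sub q n} → (S ≟ˢ T) ≡ true → S ≡ T
≟ˢ-sound S≟T =
  mem-injective (λ v → toWitness (Equivalence.from T-≡ (allᵇ-∈ _ S≟T (allVecs-complete v))))

≟ˢ-refl : ∀ {q n} (S : Sub q n) → (S ≟ˢ S) ≡ true
≟ˢ-refl {q} {n} S = allᵇ-universal _ (λ v → ≟-diag (mem S v)) (allVecs q n)
  where
  ≟-diag : ∀ b → ⌊ b B.≟ b ⌋ ≡ true
  ≟-diag true  = refl
  ≟-diag false = refl

mem-∩ : ∀ {q n} (S T : Sub q n) v → mem (S ∩ T) v ≡ (mem S v ∧ mem T v)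
mem-∩ {n = zero}  S T []      = refl
mem-∩ {n = suc n} S T (a ∷ v) rewrite lookup-zipWith _∩_ a S T = mem-∩ (lookup S a) (lookup T a) v

⊆ᵇ-Implies : ∀ {q n} {z y : Sub q n} → (z ⊆ᵇ y) ≡ true → Implies (mem z) (mem y)
⊆ᵇ-Implies z⊆y w zw = →ᵇ-elim (allᵇ-∈ _ z⊆y (allVecs-complete w)) zw

module RingSums {c ℓ : Level} (R : CommutativeRing c ℓ) where
  open CommutativeRing R
    using (Carrier; _≈_; +-cong; +-congˡ; +-congʳ)
    renaming ( _+_ to _+ᴿ_; 0# to 0ᴿ; refl to ≈-refl; trans to ≈-trans
             ; +-identityˡ to +ᴿ-identityˡ; +-identityʳ to +ᴿ-identityʳ)

  sumOver : List A → (A → Carrier) → Carrier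
  sumOver xs f = foldr (λ w acc → f w +ᴿ acc) 0ᴿ xs

  sumOver-zero : (f : A → Carrier) {xs : List A} → All (λ w → f w ≈ 0ᴿ) xs → sumOver xs f ≈ 0ᴿ
  sumOver-zero f All.[]            = ≈-refl
  sumOver-zero f (fx≈0 All.∷ rest) = ≈-trans (+-cong fx≈0 (sumOver-zero f rest)) (+ᴿ-identityˡ 0ᴿ)

  sumOver-single : (f : A → Carrier) {xs : List A} {z : A} → Unique xs → z ∈ xs →
                   (∀ w → w ≢ z → f w ≈ 0ᴿ) → sumOver xs f ≈ f z
  sumOver-single f (z∉xs AllPairs.∷ _) (here refl) vanish =
    ≈-trans (+-congˡ (sumOver-zero f (All.map (λ z≢w → vanish _ (z≢w ∘ sym)) z∉xs))) (+ᴿ-identityʳ _)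
  sumOver-single f (x∉xs AllPairs.∷ unique) (there z∈xs) vanish =
    ≈-trans (+-congʳ (vanish _ (All.lookup x∉xs z∈xs)))
          (≈-trans (+ᴿ-identityˡ _) (sumOver-single f unique z∈xs vanish))

-- Base-q logarithm

firstSuch-suc : (p : ℕ → Bool) (ds : List ℕ) {j : ℕ} → firstSuch p ds ≡ suc j → p (suc j) ≡ true
firstSuch-suc p (d ∷ ds) eq with p d in pd
... | true  = subst (λ e → p e ≡ true) eq pd
... | false = firstSuch-suc p ds eq

firstSuch-unique : (p : ℕ → Bool) {ds : List ℕ} {e : ℕ} → e ∈ ds → p e ≡ true →
                   (∀ d → p d ≡ true → d ≡ e) → firstSuch p ds ≡ e
firstSuch-unique p {d ∷ _} (here refl) pe unique rewrite pe = refl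
firstSuch-unique p {d ∷ _} (there e∈ds) pe unique with p d in pd
... | true  = unique d pd
... | false = firstSuch-unique p e∈ds pe unique

^-logq : ∀ q c {j} → logq q c ≡ suc j → q ^ suc j ≡ c
^-logq q c eq = ≡ᵇ⇒≡ _ _ (Equivalence.from T-≡ (firstSuch-suc _ (upTo (suc c)) eq))

module _ {q : ℕ} (q>1 : 1 < q) where

  private instance
    q-nonZero : NonZero q
    q-nonZero = >-nonZero (<-trans z<s q>1)

  n<q^n : ∀ n → n < q ^ n
  n<q^n zero    = z<s
  n<q^n (suc n) = ≤-<-trans (n<q^n n) (^-monoʳ-< q q>1 (n<1+n n))

  ^-injective : ∀ {d e} → q ^ d ≡ q ^ e → d ≡ e
  ^-injective {d} {e} q^d≡q^e with <-cmp d e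
  ... | tri< d<e _ _ = ⊥-elim (<⇒≢ (^-monoʳ-< q q>1 d<e) q^d≡q^e)
  ... | tri≈ _ d≡e _ = d≡e
  ... | tri> _ _ e<d = ⊥-elim (<⇒≢ (^-monoʳ-< q q>1 e<d) (sym q^d≡q^e))

  logq-^ : ∀ e → logq q (q ^ e) ≡ e
  logq-^ e = firstSuch-unique _ (∈-upTo⁺ (s≤s (<⇒≤ (n<q^n e))))
    (Equivalence.to T-≡ (≡⇒≡ᵇ (q ^ e) (q ^ e) refl))
    (λ d q^d≡ᵇq^e → ^-injective (≡ᵇ⇒≡ _ _ (Equivalence.from T-≡ q^d≡ᵇq^e)))

  logq-q* : ∀ c → logq q (q * c) ≤ logq q c + 1
  logq-q* c with logq q (q * c) in eq
  ... | zero  = z≤n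
  ... | suc j = ≤-reflexive (trans (cong suc (trans (sym (logq-^ j)) (cong (logq q) q^j≡c))) (+-comm 1 _))
    where
    q^j≡c : q ^ j ≡ c
    q^j≡c = *-cancelˡ-≡ (q ^ j) c q (^-logq q (q * c) eq)

  -- logq also returns 0 on non-powers of q, so for k = 0 it is 1 ≤ c that forces c = 1.
  logq-suc⇒≡q* : ∀ {c c′ k} → logq q c ≡ k → logq q c′ ≡ suc k → 1 ≤ c → q * c ≤ c′ →
                 c′ ≡ q * c
  logq-suc⇒≡q* {c} {c′} {suc j} eq eq′ _ _ =
    trans (sym (^-logq q c′ eq′)) (cong (q *_) (^-logq q c eq))
  logq-suc⇒≡q* {c} {c′} {zero}  _  eq′ 1≤c q*c≤c′ =
    trans (sym (^-logq q c′ eq′)) (cong (q *_) (sym c≡1))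
    where
    c≡1 : c ≡ 1
    c≡1 = ≤-antisym (*-cancelˡ-≤ q (≤-trans q*c≤c′ (≤-reflexive (sym (^-logq q c′ eq′))))) 1≤c

distinct⇒1< : ∀ {n} {a b : Fin n} → a ≢ b → 1 < n
distinct⇒1< {zero}        {()}
distinct⇒1< {suc zero}    {F.zero} {F.zero} a≢b = ⊥-elim (a≢b refl)
distinct⇒1< {suc (suc n)} _ = s≤s z<s

1<q : ∀ {q} → FiniteField q → 1 < q
1<q 𝔽 = distinct⇒1< (FiniteField.0≢1 𝔽)

module Vectors {q : ℕ} (𝔽 : FiniteField q) where
  open FiniteField 𝔽 renaming (_+_ to infixl 6 _+ᶠ_; _*_ to infixl 7 _*ᶠ_; -_ to infix 8 -_)

  commutativeRing : CommutativeRing 0ℓ 0ℓ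
  commutativeRing = record { isCommutativeRing = isCommutativeRing }

  open CommutativeRing commutativeRing
    using (ring; +-group; *-assoc; *-identityˡ; *-comm) renaming (+-comm to +ᶠ-comm; +-assoc to +ᶠ-assoc)
  open import Algebra.Properties.Ring ring using (-1*x≈-x; [y-z]x≈yx-zx)
  open import Algebra.Properties.Group +-group
    using (//-rightDividesˡ; //-rightDividesʳ; \\-leftDividesʳ; x∙y⁻¹≈ε⇒x≈y)
  open import Algebra.Properties.AbelianGroup (CommutativeRing.+-abelianGroup commutativeRing)
    using (⁻¹-anti-homo‿-)
  open ≡-Reasoning

  infixl 6 _⊕_ _⊖_
  infixr 7 _·_

  _⊕_ : ∀ {n} → Vec (Fin q) n → Vec (Fin q) n → Vec (Fin q) n
  _⊕_ = zipWith _+ᶠ_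

  _·_ : ∀ {n} → Fin q → Vec (Fin q) n → Vec (Fin q) n
  c · v = V.map (c *ᶠ_) v

  _⊖_ : ∀ {n} → Vec (Fin q) n → Vec (Fin q) n → Vec (Fin q) n
  u ⊖ v = u ⊕ (- 1#) · v

  ⊕-⊖-cancel : ∀ {n} (w u : Vec (Fin q) n) → (w ⊕ u) ⊖ u ≡ w
  ⊕-⊖-cancel []      []      = refl
  ⊕-⊖-cancel (a ∷ w) (b ∷ u) =
    cong₂ _∷_ (trans (cong ((a +ᶠ b) +ᶠ_) (-1*x≈-x b)) (//-rightDividesʳ b a)) (⊕-⊖-cancel w u)

  ⊖-⊕-cancel : ∀ {n} (w u : Vec (Fin q) n) → (w ⊖ u) ⊕ u ≡ w
  ⊖-⊕-cancel []      []      = refl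
  ⊖-⊕-cancel (a ∷ w) (b ∷ u) =
    cong₂ _∷_ (trans (cong (λ x → (a +ᶠ x) +ᶠ b) (-1*x≈-x b)) (//-rightDividesˡ b a)) (⊖-⊕-cancel w u)

  ⊖-⊖-· : ∀ {n} c c′ (w v : Vec (Fin q) n) → (w ⊖ c′ · v) ⊖ (w ⊖ c · v) ≡ (c +ᶠ - c′) · v
  ⊖-⊖-· c c′ []      []      = refl
  ⊖-⊖-· c c′ (a ∷ w) (b ∷ v) = cong₂ _∷_ difference (⊖-⊖-· c c′ w v)
    where
    difference : (a +ᶠ - 1# *ᶠ (c′ *ᶠ b)) +ᶠ - 1# *ᶠ (a +ᶠ - 1# *ᶠ (c *ᶠ b)) ≡ (c +ᶠ - c′) *ᶠ b
    difference = begin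
      (a +ᶠ - 1# *ᶠ (c′ *ᶠ b)) +ᶠ - 1# *ᶠ (a +ᶠ - 1# *ᶠ (c *ᶠ b))
        ≡⟨ cong₂ (λ x y → (a +ᶠ x) +ᶠ - 1# *ᶠ (a +ᶠ y)) (-1*x≈-x (c′ *ᶠ b)) (-1*x≈-x (c *ᶠ b)) ⟩
      (a +ᶠ - (c′ *ᶠ b)) +ᶠ - 1# *ᶠ (a +ᶠ - (c *ᶠ b))
        ≡⟨ cong (a +ᶠ - (c′ *ᶠ b) +ᶠ_) (-1*x≈-x _) ⟩
      (a +ᶠ - (c′ *ᶠ b)) +ᶠ - (a +ᶠ - (c *ᶠ b))
        ≡⟨ cong (a +ᶠ - (c′ *ᶠ b) +ᶠ_) (⁻¹-anti-homo‿- a (c *ᶠ b)) ⟩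
      (a +ᶠ - (c′ *ᶠ b)) +ᶠ (c *ᶠ b +ᶠ - a)    ≡⟨ +ᶠ-comm _ _ ⟩
      (c *ᶠ b +ᶠ - a) +ᶠ (a +ᶠ - (c′ *ᶠ b))    ≡⟨ +ᶠ-assoc _ _ _ ⟩
      c *ᶠ b +ᶠ (- a +ᶠ (a +ᶠ - (c′ *ᶠ b)))    ≡⟨ cong (c *ᶠ b +ᶠ_) (\\-leftDividesʳ a _) ⟩
      c *ᶠ b +ᶠ - (c′ *ᶠ b)                    ≡⟨ [y-z]x≈yx-zx b c c′ ⟨
      (c +ᶠ - c′) *ᶠ b                         ∎

  ·-assoc : ∀ {n} c d (v : Vec (Fin q) n) → c · d · v ≡ (c *ᶠ d) · v
  ·-assoc c d []      = refl
  ·-assoc c d (b ∷ v) = cong₂ _∷_ (sym (*-assoc c d b)) (·-assoc c d v)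

  ·-identityˡ : ∀ {n} (v : Vec (Fin q) n) → 1# · v ≡ v
  ·-identityˡ []      = refl
  ·-identityˡ (b ∷ v) = cong₂ _∷_ (*-identityˡ b) (·-identityˡ v)

  ·-invertible : ∀ {n} {c c′} (v : Vec (Fin q) n) → c ≢ c′ → ∃ λ d → d · (c +ᶠ - c′) · v ≡ v
  ·-invertible {c = c} {c′} v c≢c′ with inverse (c +ᶠ - c′) (c≢c′ ∘ x∙y⁻¹≈ε⇒x≈y c c′)
  ... | d , [c-c′]d≡1 =
    d , trans (·-assoc d _ v) (trans (cong (_· v) (trans (*-comm d _) [c-c′]d≡1)) (·-identityˡ v))

module Subspaces {q : ℕ} (𝔽 : FiniteField q) (N : ℕ) where
  open FiniteField 𝔽 using (1#; -_)
  open Vectors 𝔽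
  open Space 𝔽 N using (isSubspace; zeroV)

  Point : Set
  Point = Vec (Fin q) N

  count : (Point → Bool) → ℕ
  count S = countᵇ S (allVecs q N)

  record LinearlyClosed (S : Point → Bool) : Set where
    field
      ⊕-closed : ∀ {u v} → S u ≡ true → S v ≡ true → S (u ⊕ v) ≡ true
      ·-closed : ∀ c {u} → S u ≡ true → S (c · u) ≡ true

    ⊖-closed : ∀ {u v} → S u ≡ true → S v ≡ true → S (u ⊖ v) ≡ true
    ⊖-closed Su Sv = ⊕-closed Su (·-closed (- 1#) Sv)

  open LinearlyClosed

  isSubspace⇒zero : ∀ {S} → isSubspace S ≡ true → mem S zeroV ≡ true
  isSubspace⇒zero {S} subspace = ∧-conicalˡ (mem S zeroV) _ subspace

  isSubspace⇒LinearlyClosed : ∀ {S} → isSubspace S ≡ true → LinearlyClosed (mem S)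
  isSubspace⇒LinearlyClosed {S} subspace = record
    { ⊕-closed = λ {u} {v} Su Sv →
        →ᵇ-elim (allᵇ-∈ (⊕-law u) (allᵇ-∈ (λ u → allᵇ (⊕-law u) points) ⊕-laws (allVecs-complete u))
                        (allVecs-complete v))
                (∧-intro Su Sv)
    ; ·-closed = λ c {u} Su →
        →ᵇ-elim (allᵇ-∈ (·-law c) (allᵇ-∈ (λ c → allᵇ (·-law c) points) ·-laws (∈-allFin c))
                        (allVecs-complete u))
                Su
    }
    where
    points = allVecs q N
    ⊕-law : Point → Point → Bool
    ⊕-law u v = not (mem S u ∧ mem S v) ∨ mem S (u ⊕ v)
    ·-law : Fin q → Point → Bool
    ·-law c v = not (mem S v) ∨ mem S (c · v)
    laws = ∧-conicalʳ (mem S zeroV) _ subspace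
    ⊕-laws = ∧-conicalˡ (allᵇ (λ u → allᵇ (⊕-law u) points) points) _ laws
    ·-laws = ∧-conicalʳ (allᵇ (λ u → allᵇ (⊕-law u) points) points) _ laws

  ∧-LinearlyClosed : ∀ {S S′} → LinearlyClosed S → LinearlyClosed S′ →
                     LinearlyClosed (λ w → S w ∧ S′ w)
  ∧-LinearlyClosed {S} closed closed′ = record
    { ⊕-closed = λ {u} {v} SS′u SS′v →
        ∧-intro (⊕-closed closed (∧-conicalˡ (S u) _ SS′u) (∧-conicalˡ (S v) _ SS′v))
                (⊕-closed closed′ (∧-conicalʳ (S u) _ SS′u) (∧-conicalʳ (S v) _ SS′v))
    ; ·-closed = λ c {u} SS′u →
        ∧-intro (·-closed closed c (∧-conicalˡ (S u) _ SS′u))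
                (·-closed closed′ c (∧-conicalʳ (S u) _ SS′u))
    }

  infixl 6 _+⟨_⟩

  _+⟨_⟩ : (Point → Bool) → Point → Point → Bool
  (S +⟨ v ⟩) w = any (λ c → S (w ⊖ c · v)) (allFin q)

  +⟨⟩-intro : ∀ S {v w} c → S (w ⊖ c · v) ≡ true → (S +⟨ v ⟩) w ≡ true
  +⟨⟩-intro S c S[w-cv] = Equivalence.to T-≡ (any⁺ _ (lose (∈-allFin c) (Equivalence.from T-≡ S[w-cv])))

  +⟨⟩-elim : ∀ S {v w} → (S +⟨ v ⟩) w ≡ true → ∃ λ c → S (w ⊖ c · v) ≡ true
  +⟨⟩-elim S {v} {w} S+vw with find (any⁻ (λ c → S (w ⊖ c · v)) (allFin q) (Equivalence.from T-≡ S+vw))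
  ... | c , _ , S[w-cv] = c , Equivalence.to T-≡ S[w-cv]

  count-translate : ∀ S u → count (λ w → S (w ⊖ u)) ≡ count S
  count-translate S u = countᵇ-∘-bijection S (allVecs-unique q N) allVecs-complete
    (_⊖ u) (_⊕ u) (λ w → ⊕-⊖-cancel w u) (λ w → ⊖-⊕-cancel w u)

  count-+⟨⟩ : ∀ {S v} → LinearlyClosed S → S v ≡ false → count (S +⟨ v ⟩) ≡ q * count S
  count-+⟨⟩ {S} {v} closed Sv≡false =
    trans (countᵇ-any (λ c w → S (w ⊖ c · v)) (Unique.allFin⁺ q) sameTranslate (allVecs q N)
                      (λ c → count-translate S (c · v)))
          (cong (_* count S) (length-tabulate {n = q} id))
    where
    -- (w ⊖ c′ · v) ⊖ (w ⊖ c · v) = (c - c′) · v, so a common point of two translates puts v in S.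
    sameTranslate : ∀ {c c′} w → S (w ⊖ c · v) ≡ true → S (w ⊖ c′ · v) ≡ true → c ≡ c′
    sameTranslate {c} {c′} w S[w-cv] S[w-c′v] with c F.≟ c′
    ... | yes c≡c′ = c≡c′
    ... | no  c≢c′ with ·-invertible v c≢c′
    ...   | d , d[c-c′]v≡v = ⊥-elim (not-¬ Sv Sv≡false)
      where
      Sv : S v ≡ true
      Sv = subst (λ u → S u ≡ true) d[c-c′]v≡v (·-closed closed d S[[c-c′]v])
        where
        S[[c-c′]v] = subst (λ u → S u ≡ true) (⊖-⊖-· c c′ w v) (⊖-closed closed S[w-c′v] S[w-cv])

  +⟨⟩-Implies : ∀ {S S′ : Point → Bool} {v} → LinearlyClosed S′ → Implies S S′ → S′ v ≡ true →
                Implies (S +⟨ v ⟩) S′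
  +⟨⟩-Implies {S} {S′} {v} closed′ S⇒S′ S′v w S+vw with +⟨⟩-elim S {v} {w} S+vw
  ... | c , S[w-cv] = subst (λ u → S′ u ≡ true) (⊖-⊕-cancel w (c · v))
                            (⊕-closed closed′ (S⇒S′ _ S[w-cv]) (·-closed closed′ c S′v))

  ∧-+⟨⟩ : ∀ {Y X X′ : Point → Bool} {v} → LinearlyClosed Y → Y v ≡ true →
          (∀ w → X′ w ≡ (X +⟨ v ⟩) w) → ∀ w → (Y w ∧ X′ w) ≡ ((λ u → Y u ∧ X u) +⟨ v ⟩) w
  ∧-+⟨⟩ {Y} {X} {X′} {v} closed Yv X′≐X+v w = ⇔→≡ (mk⇔ into back)
    where
    into : Y w ∧ X′ w ≡ true → ((λ u → Y u ∧ X u) +⟨ v ⟩) w ≡ true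
    into YX′w with +⟨⟩-elim X {v} {w} (trans (sym (X′≐X+v w)) (∧-conicalʳ (Y w) _ YX′w))
    ... | c , X[w-cv] = +⟨⟩-intro (λ u → Y u ∧ X u) {v} {w} c
      (∧-intro (⊖-closed closed (∧-conicalˡ (Y w) _ YX′w) (·-closed closed c Yv)) X[w-cv])
    back : ((λ u → Y u ∧ X u) +⟨ v ⟩) w ≡ true → Y w ∧ X′ w ≡ true
    back YX+vw with +⟨⟩-elim (λ u → Y u ∧ X u) {v} {w} YX+vw
    ... | c , YX[w-cv] = ∧-intro
      (subst (λ u → Y u ≡ true) (⊖-⊕-cancel w (c · v))
             (⊕-closed closed (∧-conicalˡ (Y (w ⊖ c · v)) _ YX[w-cv]) (·-closed closed c Yv)))
      (trans (X′≐X+v w) (+⟨⟩-intro X {v} {w} c (∧-conicalʳ (Y (w ⊖ c · v)) _ YX[w-cv])))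

module FlagGeometry {q : ℕ} (𝔽 : FiniteField q) (N : ℕ) (x : Fin (suc N) → Sub q N)
                    (flag : Space.IsFullFlag 𝔽 N x) where
  open Space 𝔽 N using (isSubspace; dim)
  open Space.IsFullFlag flag
  open Space.Flag 𝔽 N x using (location; covers; unit)
  open Subspaces 𝔽 N

  card-∩ : (z y : Sub q N) → card (z ∩ y) ≡ count (λ w → mem z w ∧ mem y w)
  card-∩ z y = countᵇ-cong (mem-∩ z y) (allVecs q N)

  module _ (k : Fin N) where
    private
      X X′ : Sub q N
      X  = x (inject₁ k)
      X′ = x (F.suc k)

      X-closed : LinearlyClosed (mem X)
      X-closed = isSubspace⇒LinearlyClosed (subspace (inject₁ k))

      X′-closed : LinearlyClosed (mem X′)
      X′-closed = isSubspace⇒LinearlyClosed (subspace (F.suc k))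

      X⇒X′ : Implies (mem X) (mem X′)
      X⇒X′ = ⊆ᵇ-Implies (nested k)

    card-flag-step : ∀ {v} → mem X′ v ≡ true → mem X v ≡ false → card X′ ≡ q * card X
    card-flag-step {v} X′v Xv≡false = logq-suc⇒≡q* (1<q 𝔽)
      (trans (dimension (inject₁ k)) (toℕ-inject₁ k)) (dimension (F.suc k))
      (countᵇ-positive (mem X) (allVecs-complete _) (isSubspace⇒zero (subspace (inject₁ k))))
      (subst (_≤ card X′) (count-+⟨⟩ X-closed Xv≡false)
             (countᵇ-mono _ (mem X′) (+⟨⟩-Implies X′-closed X⇒X′ X′v) (allVecs q N)))

    -- X + F_q v ⊆ X′, and both have q · |X| points.
    flag-step-+⟨⟩ : ∀ {v} → mem X′ v ≡ true → mem X v ≡ false →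
                    ∀ w → mem X′ w ≡ (mem X +⟨ v ⟩) w
    flag-step-+⟨⟩ {v} X′v Xv≡false w = ⇔→≡ (mk⇔ (X′⇒X+v w) (X+v⇒X′ w))
      where
      X+v⇒X′ : Implies (mem X +⟨ v ⟩) (mem X′)
      X+v⇒X′ = +⟨⟩-Implies X′-closed X⇒X′ X′v
      X′⇒X+v : Implies (mem X′) (mem X +⟨ v ⟩)
      X′⇒X+v w X′w = countᵇ-≡⇒Implies (mem X +⟨ v ⟩) (mem X′) X+v⇒X′
        (trans (count-+⟨⟩ X-closed Xv≡false) (sym (card-flag-step X′v Xv≡false))) (allVecs-complete w) X′w

    card-∩-flag-step : ∀ {z v} → isSubspace z ≡ true →
                       mem z v ≡ true → mem X′ v ≡ true → mem X v ≡ false →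
                       card (z ∩ X′) ≡ q * card (z ∩ X)
    card-∩-flag-step {z} {v} z-subspace zv X′v Xv≡false = begin
      card (z ∩ X′)                               ≡⟨ card-∩ z X′ ⟩
      count (λ w → mem z w ∧ mem X′ w)
        ≡⟨ countᵇ-cong (∧-+⟨⟩ {X = mem X} z-closed zv (flag-step-+⟨⟩ X′v Xv≡false)) (allVecs q N) ⟩
      count ((λ w → mem z w ∧ mem X w) +⟨ v ⟩)
        ≡⟨ count-+⟨⟩ (∧-LinearlyClosed z-closed X-closed) zXv≡false ⟩
      q * count (λ w → mem z w ∧ mem X w)         ≡⟨ cong (q *_) (card-∩ z X) ⟨
      q * card (z ∩ X)                            ∎
      where
      open ≡-Reasoning
      z-closed = isSubspace⇒LinearlyClosed z-subspace
      zXv≡false : mem z v ∧ mem X v ≡ false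
      zXv≡false = trans (cong (mem z v ∧_) Xv≡false) (∧-zeroʳ (mem z v))

    card-∩-flag-stable : ∀ {z} → (∀ w → mem z w ∧ mem X′ w ≡ true → mem X w ≡ true) →
                         card (z ∩ X′) ≡ card (z ∩ X)
    card-∩-flag-stable {z} stays =
      trans (card-∩ z X′) (trans (countᵇ-cong same (allVecs q N)) (sym (card-∩ z X)))
      where
      same : ∀ w → (mem z w ∧ mem X′ w) ≡ (mem z w ∧ mem X w)
      same w = ⇔→≡ (mk⇔
        (λ zX′w → ∧-intro (∧-conicalˡ (mem z w) _ zX′w) (stays w zX′w))
        (λ zXw → ∧-intro (∧-conicalˡ (mem z w) _ zXw) (X⇒X′ w (∧-conicalʳ (mem z w) _ zXw))))

    dim-∩-flag-step : ∀ {z} → isSubspace z ≡ true → dim (z ∩ X′) ≤ dim (z ∩ X) + 1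
    dim-∩-flag-step {z} z-subspace with any? (λ w → T? (escapes w)) (allVecs q N)
      where
      escapes : Point → Bool
      escapes w = (mem z w ∧ mem X′ w) ∧ not (mem X w)
    ... | yes escape with find escape
    ...   | v , _ , escapes-v =
      subst (λ c → logq q c ≤ dim (z ∩ X) + 1) (sym card-step) (logq-q* (1<q 𝔽) (card (z ∩ X)))
      where
      zX′v = ∧-conicalˡ (mem z v ∧ mem X′ v) _ (Equivalence.to T-≡ escapes-v)
      ¬Xv = ∧-conicalʳ (mem z v ∧ mem X′ v) _ (Equivalence.to T-≡ escapes-v)
      card-step = card-∩-flag-step z-subspace (∧-conicalˡ (mem z v) _ zX′v) (∧-conicalʳ (mem z v) _ zX′v)
                                   (trans (sym (not-involutive _)) (cong not ¬Xv))
    dim-∩-flag-step {z} z-subspace | no ¬escape =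
      subst (λ c → logq q c ≤ dim (z ∩ X) + 1) (sym (card-∩-flag-stable stays)) (m≤m+n _ 1)
      where
      stays : ∀ w → mem z w ∧ mem X′ w ≡ true → mem X w ≡ true
      stays w zX′w with mem X w in Xw
      ... | true  = refl
      ... | false =
        ⊥-elim (¬escape (lose (allVecs-complete w) (Equivalence.from T-≡ (∧-intro zX′w (cong not Xw)))))

  location≤1 : ∀ {z} → isSubspace z ≡ true → ∀ k → location z k ≤ 1
  location≤1 z-subspace k = m≤n+o⇒m∸n≤o _ _ (dim-∩-flag-step k z-subspace)

  covers-location : ∀ {m y z} → covers m y z ≡ true → ∀ k → location y k ≡ location z k + unit m k
  covers-location {m} {y} {z} y-covers-z k =
    ≡ᵇ⇒≡ _ _ (Equivalence.from T-≡
      (allᵇ-∈ (λ k → location y k ≡ᵇ (location z k + unit m k)) locations (∈-allFin k)))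
    where
    locations = ∧-conicalʳ (dim y ≡ᵇ suc (dim z)) _ (∧-conicalʳ (z ⊆ᵇ y) _ y-covers-z)

  unit-≢ : ∀ {m n} → m ≢ n → unit m n ≡ 0
  unit-≢ {m} {n} m≢n with n F.≟ m
  ... | yes n≡m = ⊥-elim (m≢n (sym n≡m))
  ... | no  _   = refl

  unit-≡ : ∀ m → unit m m ≡ 1
  unit-≡ m with m F.≟ m
  ... | yes _   = refl
  ... | no  m≢m = ⊥-elim (m≢m refl)

  covers-location-≢ : ∀ {m n y z} → covers m y z ≡ true → m ≢ n → location y n ≡ location z n
  covers-location-≢ {m} {n} {y} {z} y-covers-z m≢n =
    trans (covers-location y-covers-z n) (trans (cong (location z n +_) (unit-≢ m≢n)) (+-identityʳ _))

  covers-location-≡ : ∀ {m y z} → isSubspace y ≡ true → covers m y z ≡ true →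
                      location y m ≡ 1 × location z m ≡ 0
  covers-location-≡ {m} {y} {z} y-subspace y-covers-z =
    trans location-y (cong (_+ 1) location-z) , location-z
    where
    location-y : location y m ≡ location z m + 1
    location-y = trans (covers-location y-covers-z m) (cong (location z m +_) (unit-≡ m))
    z+1≤1 : location z m + 1 ≤ 1
    z+1≤1 = subst (_≤ 1) location-y (location≤1 y-subspace m)
    location-z : location z m ≡ 0
    location-z = n≤0⇒n≡0 (+-cancelʳ-≤ 1 _ 0 z+1≤1)

module Commutation {c ℓ : Level} (R : CommutativeRing c ℓ) {q : ℕ} (𝔽 : FiniteField q) (N : ℕ)
    (x : Fin (suc N) → Sub q N) (flag : Space.IsFullFlag 𝔽 N x)
    (s t : CommutativeRing.Carrier R)
    (st≈1 : CommutativeRing._≈_ R (CommutativeRing._*_ R s t) (CommutativeRing.1# R))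
    (ss≈q : CommutativeRing._≈_ R (CommutativeRing._*_ R s s) (Space.Flag.Mat.fromℕ 𝔽 N x R s t q)) where
  open Space 𝔽 N using (isSubspace; P)
  open Space.Flag 𝔽 N x using (location; covers)
  open Space.Flag.Mat 𝔽 N x R s t
  open FlagGeometry 𝔽 N x flag using (covers-location-≢; covers-location-≡)
  open RingSums R using (sumOver-single)
  open CommutativeRing R
    using (Carrier; _≈_; reflexive; *-congˡ; *-congʳ; *-assoc; *-identityˡ; *-identityʳ; zeroˡ; zeroʳ; setoid)
    renaming (_*_ to _*ᴿ_; 0# to 0ᴿ; 1# to 1ᴿ; sym to ≈-sym; trans to ≈-trans; *-commutativeSemigroup to *-cs)
  open import Algebra.Properties.CommutativeSemigroup *-cs using (x∙yz≈y∙xz)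
  open import Relation.Binary.Reasoning.Setoid setoid

  κ : Fin N → Sub q N → Carrier
  κ n y = if location y n ≡ᵇ 0 then s else t

  P-unique : Unique P
  P-unique = Unique.filter⁺ (T? ∘ isSubspace) (allSub-unique q N)

  P-complete : ∀ {y} → isSubspace y ≡ true → y ∈ P
  P-complete {y} y-subspace =
    ∈-filter⁺ (T? ∘ isSubspace) (allSub-complete q N y) (Equivalence.from T-≡ y-subspace)

  K-diagonal : ∀ n y → K n y y ≡ κ n y
  K-diagonal n y rewrite ≟ˢ-refl y = refl

  ⊗-K : ∀ A n y z → isSubspace z ≡ true → (A ⊗ K n) y z ≈ A y z *ᴿ κ n z
  ⊗-K A n y z z-subspace =
    ≈-trans (sumOver-single (λ w → A y w *ᴿ K n w z) P-unique (P-complete z-subspace) offDiagonal)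
            (reflexive (cong (A y z *ᴿ_) (K-diagonal n z)))
    where
    offDiagonal : ∀ w → w ≢ z → A y w *ᴿ K n w z ≈ 0ᴿ
    offDiagonal w w≢z with w ≟ˢ z in w≟z
    ... | true  = ⊥-elim (w≢z (≟ˢ-sound w≟z))
    ... | false = zeroʳ _

  K-⊗ : ∀ A n y z → isSubspace y ≡ true → (K n ⊗ A) y z ≈ κ n y *ᴿ A y z
  K-⊗ A n y z y-subspace =
    ≈-trans (sumOver-single (λ w → K n y w *ᴿ A w z) P-unique (P-complete y-subspace) offDiagonal)
            (reflexive (cong (_*ᴿ A y z) (K-diagonal n y)))
    where
    offDiagonal : ∀ w → w ≢ y → K n y w *ᴿ A w z ≈ 0ᴿ
    offDiagonal w w≢y with y ≟ˢ w in y≟w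
    ... | true  = ⊥-elim (w≢y (sym (≟ˢ-sound y≟w)))
    ... | false = zeroˡ _

  κ-cong : ∀ {n y z} → location y n ≡ location z n → κ n y ≡ κ n z
  κ-cong {n} y≡z = cong (λ l → if l ≡ᵇ 0 then s else t) y≡z

  κ-covered : ∀ {m y z} → isSubspace y ≡ true → covers m y z ≡ true → κ m y ≡ t × κ m z ≡ s
  κ-covered {m} {y} {z} y-subspace y-covers-z
    with location y m | location z m | covers-location-≡ {m} {y} {z} y-subspace y-covers-z
  ... | _ | _ | refl , refl = refl , refl

  q*t≈s : fromℕ q *ᴿ t ≈ s
  q*t≈s = begin
    fromℕ q *ᴿ t     ≈⟨ *-congʳ ss≈q ⟨
    (s *ᴿ s) *ᴿ t    ≈⟨ *-assoc s s t ⟩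
    s *ᴿ (s *ᴿ t)    ≈⟨ *-congˡ st≈1 ⟩
    s *ᴿ 1ᴿ          ≈⟨ *-identityʳ s ⟩
    s                ∎

  indicator-comm : ∀ b {a a′} → (b ≡ true → a ≈ a′) →
                   (if b then 1ᴿ else 0ᴿ) *ᴿ a ≈ a′ *ᴿ (if b then 1ᴿ else 0ᴿ)
  indicator-comm true  a≈a′ = ≈-trans (*-identityˡ _) (≈-trans (a≈a′ refl) (≈-sym (*-identityʳ _)))
  indicator-comm false _    = ≈-trans (zeroˡ _) (≈-sym (zeroʳ _))

  L-K-comm : ∀ {m n} → m ≢ n → (L m ⊗ K n) ≈ᴹ (K n ⊗ L m)
  L-K-comm {m} {n} m≢n y z y-subspace z-subspace = begin
    (L m ⊗ K n) y z    ≈⟨ ⊗-K (L m) n y z z-subspace ⟩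
    L m y z *ᴿ κ n z
      ≈⟨ indicator-comm (covers m z y) (λ z-covers-y → reflexive (κ-cong (covers-location-≢ z-covers-y m≢n))) ⟩
    κ n y *ᴿ L m y z   ≈⟨ K-⊗ (L m) n y z y-subspace ⟨
    (K n ⊗ L m) y z    ∎

  R-K-comm : ∀ {m n} → m ≢ n → (R′ m ⊗ K n) ≈ᴹ (K n ⊗ R′ m)
  R-K-comm {m} {n} m≢n y z y-subspace z-subspace = begin
    (R′ m ⊗ K n) y z    ≈⟨ ⊗-K (R′ m) n y z z-subspace ⟩
    R′ m y z *ᴿ κ n z
      ≈⟨ indicator-comm (covers m y z) (λ y-covers-z → reflexive (sym (κ-cong (covers-location-≢ y-covers-z m≢n)))) ⟩
    κ n y *ᴿ R′ m y z   ≈⟨ K-⊗ (R′ m) n y z y-subspace ⟨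
    (K n ⊗ R′ m) y z    ∎

  L-K-q-comm : ∀ m → (fromℕ q • (L m ⊗ K m)) ≈ᴹ (K m ⊗ L m)
  L-K-q-comm m y z y-subspace z-subspace = begin
    fromℕ q *ᴿ (L m ⊗ K m) y z        ≈⟨ *-congˡ (⊗-K (L m) m y z z-subspace) ⟩
    fromℕ q *ᴿ (L m y z *ᴿ κ m z)     ≈⟨ x∙yz≈y∙xz _ _ _ ⟩
    L m y z *ᴿ (fromℕ q *ᴿ κ m z)     ≈⟨ indicator-comm (covers m z y) q*κz≈κy ⟩
    κ m y *ᴿ L m y z                  ≈⟨ K-⊗ (L m) m y z y-subspace ⟨
    (K m ⊗ L m) y z                   ∎
    where
    q*κz≈κy : covers m z y ≡ true → fromℕ q *ᴿ κ m z ≈ κ m y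
    q*κz≈κy z-covers-y with κ m z | κ m y | κ-covered {m} {z} {y} z-subspace z-covers-y
    ... | _ | _ | refl , refl = q*t≈s

  R-K-q-comm : ∀ m → (R′ m ⊗ K m) ≈ᴹ (fromℕ q • (K m ⊗ R′ m))
  R-K-q-comm m y z y-subspace z-subspace = begin
    (R′ m ⊗ K m) y z                  ≈⟨ ⊗-K (R′ m) m y z z-subspace ⟩
    R′ m y z *ᴿ κ m z                 ≈⟨ indicator-comm (covers m y z) κz≈q*κy ⟩
    (fromℕ q *ᴿ κ m y) *ᴿ R′ m y z    ≈⟨ *-assoc _ _ _ ⟩
    fromℕ q *ᴿ (κ m y *ᴿ R′ m y z)    ≈⟨ *-congˡ (K-⊗ (R′ m) m y z y-subspace) ⟨
    fromℕ q *ᴿ (K m ⊗ R′ m) y z       ∎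
    where
    κz≈q*κy : covers m y z ≡ true → κ m z ≈ fromℕ q *ᴿ κ m y
    κz≈q*κy y-covers-z with κ m y | κ m z | κ-covered {m} {y} {z} y-subspace y-covers-z
    ... | _ | _ | refl , refl = ≈-sym q*t≈s

proposition7p1 : ∀ {c ℓ : Level} (R : CommutativeRing c ℓ) {q : ℕ} (𝔽 : FiniteField q) (N : ℕ)
    (x : Fin (suc N) → Sub q N) → Space.IsFullFlag 𝔽 N x
    → (s t : CommutativeRing.Carrier R)
    → CommutativeRing._≈_ R (CommutativeRing._*_ R s t) (CommutativeRing.1# R)
    → CommutativeRing._≈_ R (CommutativeRing._*_ R s s) (Space.Flag.Mat.fromℕ 𝔽 N x R s t q)
    → let open Space.Flag.Mat 𝔽 N x R s t in
      (∀ (m n : Fin N) → ¬ (m ≡ n)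
        → ((L m ⊗ K n) ≈ᴹ (K n ⊗ L m)) × ((R′ m ⊗ K n) ≈ᴹ (K n ⊗ R′ m)))
      × (∀ (m : Fin N)
        → ((fromℕ q • (L m ⊗ K m)) ≈ᴹ (K m ⊗ L m)) × ((R′ m ⊗ K m) ≈ᴹ (fromℕ q • (K m ⊗ R′ m))))
proposition7p1 R 𝔽 N x flag s t st≈1 ss≈q =
  (λ m n m≢n → L-K-comm m≢n , R-K-comm m≢n) , (λ m → L-K-q-comm m , R-K-q-comm m)
  where open Commutation R 𝔽 N x flag s t st≈1 ss≈q
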